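{- Let $t$ be a $\beta$-normal $\lambda$-term, $v$ a closed $\lambda$-term, and $\alpha,x,x_1,\dots,x_n$ variables ($n\ge0$) with $\alpha\notin\{x_1,\dots,x_n\}$. If $t[\lambda x_1\dots\lambda x_n\alpha/x]\rightarrow_\beta v$, then $x\notin Fv(t)$.
   Context: $\lambda$-terms are pure $\lambda$-terms; $Fv(t)$ is the set of free variables of $t$; $t[u/x]$ is capture-avoiding substitution; $\rightarrow_\beta$ denotes $\beta$-reduction in zero or more steps. -}

module Defs where

open import Data.Nat using (ℕ; zero; suc; _+_; _≟_)
open import Data.Product using (∃)
open import Relation.Nullary using (¬_; yes; no)
open import Relation.Binary.Construct.Closure.ReflexiveTransitive using (Star)

-- Pure untyped λ-terms, de Bruijn indices (unscoped: any index may be free).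
data Term : Set where
  var : ℕ → Term
  lam : Term → Term
  app : Term → Term → Term

data _∈Fv_ : ℕ → Term → Set where
  fv-var  : ∀ {i} → i ∈Fv var i
  fv-lam  : ∀ {i t} → suc i ∈Fv t → i ∈Fv lam t
  fv-appˡ : ∀ {i t u} → i ∈Fv t → i ∈Fv app t u
  fv-appʳ : ∀ {i t u} → i ∈Fv u → i ∈Fv app t u

Closed : Term → Set
Closed t = ∀ i → ¬ (i ∈Fv t)

ext : (ℕ → ℕ) → ℕ → ℕ
ext ρ zero    = zero
ext ρ (suc i) = suc (ρ i)

rename : (ℕ → ℕ) → Term → Term
rename ρ (var i)   = var (ρ i)
rename ρ (lam t)   = lam (rename (ext ρ) t)
rename ρ (app t u) = app (rename ρ t) (rename ρ u)

exts : (ℕ → Term) → ℕ → Term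
exts σ zero    = var zero
exts σ (suc i) = rename suc (σ i)

subst : (ℕ → Term) → Term → Term
subst σ (var i)   = σ i
subst σ (lam t)   = lam (subst (exts σ) t)
subst σ (app t u) = app (subst σ t) (subst σ u)

-- t [ u / x ] : replace free variable x by u, other free variables unchanged
-- (the named-variable substitution t[u/x]).
_[_/_] : Term → Term → ℕ → Term
t [ u / x ] = subst σ t
  where
  σ : ℕ → Term
  σ y with y ≟ x
  ... | yes _ = u
  ... | no  _ = var y

_[_]₀ : Term → Term → Term
t [ s ]₀ = subst σ t
  where
  σ : ℕ → Term
  σ zero    = s
  σ (suc i) = var i

data _⟶β_ : Term → Term → Set where
  β     : ∀ {t s} → app (lam t) s ⟶β (t [ s ]₀)
  ξ-lam : ∀ {t t'} → t ⟶β t' → lam t ⟶β lam t'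
  ξ-appˡ : ∀ {t t' u} → t ⟶β t' → app t u ⟶β app t' u
  ξ-appʳ : ∀ {t u u'} → u ⟶β u' → app t u ⟶β app t u'

_⟶β*_ : Term → Term → Set
_⟶β*_ = Star _⟶β_

BetaNormal : Term → Set
BetaNormal t = ∀ t' → ¬ (t ⟶β t')

lams : ℕ → Term → Term
lams zero    t = t
lams (suc n) t = lam (lams n t)

-- λ x₁ … λ xₙ . α  where α ∉ {x₁,…,xₙ}: α is the free variable a,
-- which under the n binders has de Bruijn index n + a.
projTerm : ℕ → ℕ → Term
projTerm n a = lams n (var (n + a))

module Submission where

-- Write πₙ(α) = λx₁…λxₙ.α.  The substituted term t[πₙ(α)/x]
-- has a persistent occurrence of α whenever x ∈ Fv t: since t is β-normal,
-- every occurrence of x in t sits either inside a head-variable spine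
-- y s₁ … sₖ (which stays a spine after substitution, as long as y ≠ x) or
-- at the head of one, where x becomes a projection πₙ(α) applied to some
-- arguments.  Contracting such a projection only consumes its binders and
-- the arguments, never α itself.
--
-- The corollary follows: v would contain the free variable α, contradicting
-- that v is closed.

open import Defs
open import Data.Nat using (ℕ; zero; suc; _+_; _≟_)
open import Data.Nat.Properties using (+-suc)
open import Data.Sum using (_⊎_; inj₁; inj₂)
open import Data.Empty using (⊥-elim)
open import Relation.Nullary using (¬_; yes; no)
open import Relation.Binary.PropositionalEquality
  using (_≡_; _≢_; refl; cong; trans; sym)
open import Relation.Binary.Construct.Closure.ReflexiveTransitive using (ε; _◅_)

-- Proj c s : s = λy₁…λyₖ. c, a projection returning the free variable c
-- (under k binders c has de Bruijn index k + c).
data Proj : ℕ → Term → Set where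
  proj-var : ∀ {c} → Proj c (var c)
  proj-lam : ∀ {c s} → Proj (suc c) s → Proj c (lam s)

data ProjSpine (c : ℕ) : Term → Set where
  spine-proj : ∀ {s} → Proj c s → ProjSpine c s
  spine-app  : ∀ {s w} → ProjSpine c s → ProjSpine c (app s w)

data Neutral : Term → Set where
  neutral-var : ∀ {y} → Neutral (var y)
  neutral-app : ∀ {s w} → Neutral s → Neutral (app s w)

-- Persistent c s : s contains a projection spine onto c reachable only
-- through λ-bodies and the arguments or heads of neutral applications;
-- no β-step can destroy that occurrence of c.
data Persistent : ℕ → Term → Set where
  persist-spine : ∀ {c s} → ProjSpine c s → Persistent c s
  persist-lam   : ∀ {c s} → Persistent (suc c) s → Persistent c (lam s)
  persist-head  : ∀ {c s w} → Neutral s → Persistent c s → Persistent c (app s w)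
  persist-arg   : ∀ {c s w} → Neutral s → Persistent c w → Persistent c (app s w)

proj-subst : ∀ {c c' t} (σ : ℕ → Term) → σ c ≡ var c' → Proj c t → Proj c' (subst σ t)
proj-subst σ σc≡c' proj-var rewrite σc≡c' = proj-var
proj-subst σ σc≡c' (proj-lam p) = proj-lam (proj-subst (exts σ) (cong (rename suc) σc≡c') p)

proj-rename : ∀ {c t} (ρ : ℕ → ℕ) → Proj c t → Proj (ρ c) (rename ρ t)
proj-rename ρ proj-var = proj-var
proj-rename ρ (proj-lam p) = proj-lam (proj-rename (ext ρ) p)

neutral-rename : ∀ {t} (ρ : ℕ → ℕ) → Neutral t → Neutral (rename ρ t)
neutral-rename ρ neutral-var = neutral-var
neutral-rename ρ (neutral-app n) = neutral-app (neutral-rename ρ n)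

proj-lams : ∀ n c d → d ≡ n + c → Proj c (lams n (var d))
proj-lams zero    c d refl = proj-var
proj-lams (suc n) c d d≡ = proj-lam (proj-lams n (suc c) d (trans d≡ (sym (+-suc n c))))

proj-normal : ∀ {c s s'} → Proj c s → ¬ (s ⟶β s')
proj-normal proj-var ()
proj-normal (proj-lam p) (ξ-lam st) = proj-normal p st

-- β-steps preserve each of the three shapes; the only redex at the head of
-- a projection spine is contracted into a projection onto the same variable.
neutral-step : ∀ {s s'} → Neutral s → s ⟶β s' → Neutral s'
neutral-step (neutral-app ()) β
neutral-step (neutral-app n) (ξ-appˡ st) = neutral-app (neutral-step n st)
neutral-step (neutral-app n) (ξ-appʳ st) = neutral-app n

spine-step : ∀ {c s s'} → ProjSpine c s → s ⟶β s' → ProjSpine c s'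
spine-step (spine-proj p) st = ⊥-elim (proj-normal p st)
spine-step (spine-app (spine-proj (proj-lam p))) β = spine-proj (proj-subst _ refl p)
spine-step (spine-app sp) (ξ-appˡ st) = spine-app (spine-step sp st)
spine-step (spine-app sp) (ξ-appʳ st) = spine-app sp

persistent-step : ∀ {c s s'} → Persistent c s → s ⟶β s' → Persistent c s'
persistent-step (persist-spine sp) st = persist-spine (spine-step sp st)
persistent-step (persist-lam g) (ξ-lam st) = persist-lam (persistent-step g st)
persistent-step (persist-head () g) β
persistent-step (persist-head n g) (ξ-appˡ st) = persist-head (neutral-step n st) (persistent-step g st)
persistent-step (persist-head n g) (ξ-appʳ st) = persist-head n g
persistent-step (persist-arg () g) β
persistent-step (persist-arg n g) (ξ-appˡ st) = persist-arg (neutral-step n st) g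
persistent-step (persist-arg n g) (ξ-appʳ st) = persist-arg n (persistent-step g st)

persistent-steps : ∀ {c s s'} → Persistent c s → s ⟶β* s' → Persistent c s'
persistent-steps g ε = g
persistent-steps g (st ◅ sts) = persistent-steps (persistent-step g st) sts

proj-free : ∀ {c s} → Proj c s → c ∈Fv s
proj-free proj-var = fv-var
proj-free (proj-lam p) = fv-lam (proj-free p)

spine-free : ∀ {c s} → ProjSpine c s → c ∈Fv s
spine-free (spine-proj p) = proj-free p
spine-free (spine-app sp) = fv-appˡ (spine-free sp)

persistent-free : ∀ {c s} → Persistent c s → c ∈Fv s
persistent-free (persist-spine sp) = spine-free sp
persistent-free (persist-lam g) = fv-lam (persistent-free g)
persistent-free (persist-head _ g) = fv-appˡ (persistent-free g)
persistent-free (persist-arg _ g) = fv-appʳ (persistent-free g)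

record ProjAt (σ : ℕ → Term) (x c : ℕ) : Set where
  field
    proj-at-x    : Proj c (σ x)
    neutral-else : ∀ y → y ≢ x → Neutral (σ y)
open ProjAt

projAt-exts : ∀ {σ x c} → ProjAt σ x c → ProjAt (exts σ) (suc x) (suc c)
projAt-exts P .proj-at-x = proj-rename suc (proj-at-x P)
projAt-exts P .neutral-else zero    _    = neutral-var
projAt-exts P .neutral-else (suc y) y≢sx = neutral-rename suc (neutral-else P y (λ y≡x → y≢sx (cong suc y≡x)))

-- The head part s of a β-normal application s w is a variable spine, so
-- after such a substitution it is neutral or a projection spine onto c.
head-subst : ∀ {σ x c w} → ProjAt σ x c → ∀ s → BetaNormal (app s w) →
             Neutral (subst σ s) ⊎ ProjSpine c (subst σ s)
head-subst {x = x} P (var y) _ with y ≟ x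
... | yes refl = inj₂ (spine-proj (proj-at-x P))
... | no  y≢x  = inj₁ (neutral-else P y y≢x)
head-subst P (lam s) nf = ⊥-elim (nf _ β)
head-subst P (app s₁ s₂) nf with head-subst P s₁ (λ _ st → nf _ (ξ-appˡ st))
... | inj₁ n  = inj₁ (neutral-app n)
... | inj₂ sp = inj₂ (spine-app sp)

persistent-subst : ∀ {σ x c} → ProjAt σ x c → ∀ t → BetaNormal t → x ∈Fv t →
                   Persistent c (subst σ t)
persistent-subst P (var _) nf fv-var = persist-spine (spine-proj (proj-at-x P))
persistent-subst P (lam t) nf (fv-lam x∈t) =
  persist-lam (persistent-subst (projAt-exts P) t (λ _ st → nf _ (ξ-lam st)) x∈t)
persistent-subst P (app s w) nf (fv-appˡ x∈s) with head-subst P s nf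
... | inj₁ n  = persist-head n (persistent-subst P s (λ _ st → nf _ (ξ-appˡ st)) x∈s)
... | inj₂ sp = persist-spine (spine-app sp)
persistent-subst P (app s w) nf (fv-appʳ x∈w) with head-subst P s nf
... | inj₁ n  = persist-arg n (persistent-subst P w (λ _ st → nf _ (ξ-appʳ st)) x∈w)
... | inj₂ sp = persist-spine (spine-app sp)

single-projAt : ∀ {u c} x → Proj c u → ProjAt (λ y → var y [ u / x ]) x c
single-projAt x p .proj-at-x with x ≟ x
... | yes _   = p
... | no  x≢x = ⊥-elim (x≢x refl)
single-projAt x p .neutral-else y y≢x with y ≟ x
... | yes y≡x = ⊥-elim (y≢x y≡x)
... | no  _   = neutral-var

corollary2p1p3 : (t v : Term) (a x n : ℕ) → BetaNormal t → Closed v →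
    (t [ projTerm n a / x ]) ⟶β* v → ¬ (x ∈Fv t)
corollary2p1p3 t v a x n nf closed t[π/x]↠v x∈t = closed a (persistent-free persistent-v)
  where
  π-proj : Proj a (projTerm n a)
  π-proj = proj-lams n a (n + a) refl

  persistent-v : Persistent a v
  persistent-v = persistent-steps (persistent-subst (single-projAt x π-proj) t nf x∈t) t[π/x]↠v
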